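{- For all $\lambda$-terms: (1) Fullness: if $t\to_\beta s$ then $t\to_{\ell\ell}u$ for some $u$. (2) Persistence: if $t\to_{\ell\ell}s_1$ and $t\to_{\neg\ell\ell}s_2$ then $s_2\to_{\ell\ell}u$ for some $u$. (3) Diamond: if $t\to_{\ell\ell}s$ and $t\to_{\ell\ell}u$ with $s\neq u$, then $s\to_{\ell\ell}r$ and $u\to_{\ell\ell}r$ for some $r$.
   Context: $\lambda$-terms: $t::=x\mid\lambda x.t\mid ts$ (up to $\alpha$-equivalence); $t\{x:=s\}$ capture-avoiding substitution. $\beta$-reduction of level $k\in\mathbb N$: $(\lambda x.t)s\to_{\beta:0}t\{x:=s\}$; if $t\to_{\beta:k}t'$ then $\lambda x.t\to_{\beta:k}\lambda x.t'$, $ts\to_{\beta:k}t's$, and $st\to_{\beta:k+1}st'$. $\to_\beta=\bigcup_k\to_{\beta:k}$. Least level $\mathrm{deg}(t)\in\mathbb N\cup\{\infty\}$: $\mathrm{deg}(x)=\infty$, $\mathrm{deg}(\lambda x.t)=\mathrm{deg}(t)$, $\mathrm{deg}(ts)=0$ if $t$ is an abstraction, otherwise $\min\{\mathrm{deg}(t),\mathrm{deg}(s)+1\}$ ($\infty+1=\infty$). $t\to_{\ell\ell}s$ iff $t\to_{\beta:k}s$ with $k=\mathrm{deg}(t)$; $t\to_{\neg\ell\ell}s$ iff $t\to_{\beta:k}s$ with $\mathrm{deg}(t)<k\in\mathbb N$. -}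

module Defs where

open import Data.Nat using (ℕ; zero; suc; _<_; _⊓_)
open import Data.Product using (∃; _×_)
open import Relation.Binary.PropositionalEquality using (_≡_)

-- λ-terms up to α-equivalence: de Bruijn indices (var n refers to the n-th enclosing binder,
-- or to a free variable if n exceeds the binder depth).
data Tm : Set where
  var : ℕ → Tm
  lam : Tm → Tm
  app : Tm → Tm → Tm

ext : (ℕ → ℕ) → ℕ → ℕ
ext ρ zero    = zero
ext ρ (suc n) = suc (ρ n)

rename : (ℕ → ℕ) → Tm → Tm
rename ρ (var n)   = var (ρ n)
rename ρ (lam t)   = lam (rename (ext ρ) t)
rename ρ (app t s) = app (rename ρ t) (rename ρ s)

exts : (ℕ → Tm) → ℕ → Tm
exts σ zero    = var zero
exts σ (suc n) = rename suc (σ n)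

subst : (ℕ → Tm) → Tm → Tm
subst σ (var n)   = σ n
subst σ (lam t)   = lam (subst (exts σ) t)
subst σ (app t s) = app (subst σ t) (subst σ s)

sub0 : Tm → ℕ → Tm
sub0 s zero    = s
sub0 s (suc n) = var n

-- t [ s ]  is  t{x:=s} where x is the variable bound by the outer λ of (λx.t)
_[_] : Tm → Tm → Tm
t [ s ] = subst (sub0 s) t

data _→β[_]_ : Tm → ℕ → Tm → Set where
  β    : ∀ {t s} → app (lam t) s →β[ 0 ] (t [ s ])
  ξlam : ∀ {t t' k} → t →β[ k ] t' → lam t →β[ k ] lam t'
  ξl   : ∀ {t t' s k} → t →β[ k ] t' → app t s →β[ k ] app t' s
  ξr   : ∀ {s t t' k} → t →β[ k ] t' → app s t →β[ suc k ] app s t'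

_→β_ : Tm → Tm → Set
t →β s = ∃ λ k → t →β[ k ] s

data ℕ∞ : Set where
  fin : ℕ → ℕ∞
  ∞   : ℕ∞

suc∞ : ℕ∞ → ℕ∞
suc∞ (fin n) = fin (suc n)
suc∞ ∞       = ∞

min∞ : ℕ∞ → ℕ∞ → ℕ∞
min∞ (fin m) (fin n) = fin (m ⊓ n)
min∞ (fin m) ∞       = fin m
min∞ ∞       n       = n

-- (the second clause applies exactly when t is not an abstraction)
deg : Tm → ℕ∞
deg (var x)         = ∞
deg (lam t)         = deg t
deg (app (lam t) s) = fin 0
deg (app t s)       = min∞ (deg t) (suc∞ (deg s))

_→ℓℓ_ : Tm → Tm → Set
t →ℓℓ s = ∃ λ k → (t →β[ k ] s) × (deg t ≡ fin k)

_→¬ℓℓ_ : Tm → Tm → Set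
t →¬ℓℓ s = ∃ λ k → (t →β[ k ] s) × (∃ λ d → (deg t ≡ fin d) × (d < k))

-- The degree deg t is exactly the least level at which t can make a β-step:
--   (a) every k-step from t satisfies deg t ≤ k               (level-bounds-deg), and
--   (b) if deg t = d is finite, t has a step of level d        (step-at-deg).
-- Fullness follows at once: a β-step makes deg t finite, and (b) provides an ℓℓ-step.
-- Persistence: a step of level k above deg t leaves the reduct reducible (persistence-step);
-- a case analysis on which component of an application realises the degree shows that either
-- the ℓℓ-redex survives or an independent component still has a step; then fullness applies.
-- Diamond: two distinct steps of the same level k close in one k-step each (level-diamond),
-- the only critical pair being a β-contraction against a step inside the abstraction body,
-- which closes because steps are stable under substitution (→β-subst). Finally an ℓℓ-step of
-- level k cannot lower the degree (ℓℓ-deg-mono), so by (a) the reduct again has degree k and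
-- the closing k-steps are ℓℓ-steps.
module Submission where

open import Defs
open import Data.Nat using (zero; suc; _≤_; _<_; z≤n; s≤s)
open import Data.Nat.Properties using (≤-refl; ≤-trans; ≤-antisym; m⊓n≤m; m⊓n≤n; ⊓-glb; ⊓-sel)
open import Data.Product using (∃; _×_; _,_; proj₁; proj₂; map; map₂)
open import Data.Sum using (_⊎_; inj₁; inj₂)
open import Relation.Binary.PropositionalEquality
  using (_≡_; refl; sym; trans; cong; cong₂; module ≡-Reasoning)
open import Relation.Nullary using (¬_)

open ≡-Reasoning

rename-rename : ∀ {ρ ρ' ρ''} t → (∀ n → ρ (ρ' n) ≡ ρ'' n) →
                rename ρ (rename ρ' t) ≡ rename ρ'' t
rename-rename (var x)   h = cong var (h x)
rename-rename (lam t)   h = cong lam (rename-rename t (ext-ext h))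
  where
    ext-ext : ∀ {ρ ρ' ρ''} → (∀ n → ρ (ρ' n) ≡ ρ'' n) → ∀ n → ext ρ (ext ρ' n) ≡ ext ρ'' n
    ext-ext h zero    = refl
    ext-ext h (suc n) = cong suc (h n)
rename-rename (app t s) h = cong₂ app (rename-rename t h) (rename-rename s h)

subst-rename : ∀ {σ ρ τ} t → (∀ n → σ (ρ n) ≡ τ n) → subst σ (rename ρ t) ≡ subst τ t
subst-rename (var x)   h = h x
subst-rename (lam t)   h = cong lam (subst-rename t (exts-ext h))
  where
    exts-ext : ∀ {σ ρ τ} → (∀ n → σ (ρ n) ≡ τ n) → ∀ n → exts σ (ext ρ n) ≡ exts τ n
    exts-ext h zero    = refl
    exts-ext h (suc n) = cong (rename suc) (h n)
subst-rename (app t s) h = cong₂ app (subst-rename t h) (subst-rename s h)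

rename-subst : ∀ {ρ σ τ} t → (∀ n → rename ρ (σ n) ≡ τ n) → rename ρ (subst σ t) ≡ subst τ t
rename-subst (var x)   h = h x
rename-subst (lam t)   h = cong lam (rename-subst t (ext-exts h))
  where
    ext-exts : ∀ {ρ σ τ} → (∀ n → rename ρ (σ n) ≡ τ n) →
               ∀ n → rename (ext ρ) (exts σ n) ≡ exts τ n
    ext-exts h zero = refl
    ext-exts {ρ} {σ} {τ} h (suc n) = begin
      rename (ext ρ) (rename suc (σ n)) ≡⟨ rename-rename (σ n) (λ _ → refl) ⟩
      rename (λ m → suc (ρ m)) (σ n)    ≡⟨ rename-rename (σ n) (λ _ → refl) ⟨
      rename suc (rename ρ (σ n))       ≡⟨ cong (rename suc) (h n) ⟩
      rename suc (τ n)                  ∎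
rename-subst (app t s) h = cong₂ app (rename-subst t h) (rename-subst s h)

subst-subst : ∀ {σ τ υ} t → (∀ n → subst σ (τ n) ≡ υ n) → subst σ (subst τ t) ≡ subst υ t
subst-subst (var x)   h = h x
subst-subst (lam t)   h = cong lam (subst-subst t (exts-exts h))
  where
    exts-exts : ∀ {σ τ υ} → (∀ n → subst σ (τ n) ≡ υ n) →
                ∀ n → subst (exts σ) (exts τ n) ≡ exts υ n
    exts-exts h zero = refl
    exts-exts {σ} {τ} {υ} h (suc n) = begin
      subst (exts σ) (rename suc (τ n))    ≡⟨ subst-rename (τ n) (λ _ → refl) ⟩
      subst (λ m → rename suc (σ m)) (τ n) ≡⟨ rename-subst (τ n) (λ _ → refl) ⟨
      rename suc (subst σ (τ n))           ≡⟨ cong (rename suc) (h n) ⟩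
      rename suc (υ n)                     ∎
subst-subst (app t s) h = cong₂ app (subst-subst t h) (subst-subst s h)

subst-id : ∀ {σ} t → (∀ n → σ n ≡ var n) → subst σ t ≡ t
subst-id (var x)   h = h x
subst-id (lam t)   h = cong lam (subst-id t (exts-id h))
  where
    exts-id : ∀ {σ} → (∀ n → σ n ≡ var n) → ∀ n → exts σ n ≡ var n
    exts-id h zero    = refl
    exts-id h (suc n) = cong (rename suc) (h n)
subst-id (app t s) h = cong₂ app (subst-id t h) (subst-id s h)

subst-[] : ∀ σ t s → subst σ (t [ s ]) ≡ subst (exts σ) t [ subst σ s ]
subst-[] σ t s = begin
  subst σ (subst (sub0 s) t)                   ≡⟨ subst-subst t (λ _ → refl) ⟩
  subst (λ n → subst σ (sub0 s n)) t           ≡⟨ subst-subst t agree ⟨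
  subst (sub0 (subst σ s)) (subst (exts σ) t)  ∎
  where
    agree : ∀ n → subst (sub0 (subst σ s)) (exts σ n) ≡ subst σ (sub0 s n)
    agree zero    = refl
    agree (suc n) = trans (subst-rename (σ n) (λ _ → refl)) (subst-id (σ n) (λ _ → refl))

→β-subst : ∀ {t t' k} σ → t →β[ k ] t' → subst σ t →β[ k ] subst σ t'
→β-subst σ (β {t} {s}) rewrite subst-[] σ t s = β
→β-subst σ (ξlam p) = ξlam (→β-subst (exts σ) p)
→β-subst σ (ξl p)   = ξl (→β-subst σ p)
→β-subst σ (ξr p)   = ξr (→β-subst σ p)

infix 4 _≼_
data _≼_ : ℕ∞ → ℕ∞ → Set where
  fin≤fin : ∀ {m n} → m ≤ n → fin m ≼ fin n
  ≼∞      : ∀ {x} → x ≼ ∞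

z≼ : ∀ x → fin 0 ≼ x
z≼ (fin n) = fin≤fin z≤n
z≼ ∞       = ≼∞

≼-reflexive : ∀ {x y} → x ≡ y → x ≼ y
≼-reflexive {fin n} refl = fin≤fin ≤-refl
≼-reflexive {∞}     refl = ≼∞

≼-trans : ∀ {x y z} → x ≼ y → y ≼ z → x ≼ z
≼-trans (fin≤fin p) (fin≤fin q) = fin≤fin (≤-trans p q)
≼-trans _           ≼∞          = ≼∞

≼-antisym : ∀ {x y} → x ≼ y → y ≼ x → x ≡ y
≼-antisym (fin≤fin p) (fin≤fin q) = cong fin (≤-antisym p q)
≼-antisym ≼∞          ≼∞          = refl

≼fin⇒fin : ∀ {x k} → x ≼ fin k → ∃ λ d → x ≡ fin d
≼fin⇒fin (fin≤fin {m} _) = m , refl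

min∞-≼ˡ : ∀ x y → min∞ x y ≼ x
min∞-≼ˡ (fin m) (fin n) = fin≤fin (m⊓n≤m m n)
min∞-≼ˡ (fin m) ∞       = fin≤fin ≤-refl
min∞-≼ˡ ∞       y       = ≼∞

min∞-≼ʳ : ∀ x y → min∞ x y ≼ y
min∞-≼ʳ (fin m) (fin n) = fin≤fin (m⊓n≤n m n)
min∞-≼ʳ (fin m) ∞       = ≼∞
min∞-≼ʳ ∞       y       = ≼-reflexive refl

min∞-glb : ∀ {x y z} → z ≼ x → z ≼ y → z ≼ min∞ x y
min∞-glb (fin≤fin p) (fin≤fin q) = fin≤fin (⊓-glb p q)
min∞-glb (fin≤fin p) ≼∞          = fin≤fin p
min∞-glb ≼∞          q           = q

min∞-fin : ∀ x y {d} → min∞ x y ≡ fin d → x ≡ fin d ⊎ y ≡ fin d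
min∞-fin (fin m) (fin n) e with ⊓-sel m n
... | inj₁ m⊓n≡m = inj₁ (trans (cong fin (sym m⊓n≡m)) e)
... | inj₂ m⊓n≡n = inj₂ (trans (cong fin (sym m⊓n≡n)) e)
min∞-fin (fin m) ∞ e = inj₁ e
min∞-fin ∞       y e = inj₂ e

suc∞-mono : ∀ {x y} → x ≼ y → suc∞ x ≼ suc∞ y
suc∞-mono (fin≤fin p) = fin≤fin (s≤s p)
suc∞-mono ≼∞          = ≼∞

suc∞-cancel : ∀ {k} y → fin (suc k) ≼ suc∞ y → fin k ≼ y
suc∞-cancel (fin n) (fin≤fin (s≤s p)) = fin≤fin p
suc∞-cancel ∞       _                 = ≼∞

suc∞-fin : ∀ x {d} → suc∞ x ≡ fin d → ∃ λ m → (x ≡ fin m) × (d ≡ suc m)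
suc∞-fin (fin m) refl = m , refl , refl

-- Terms that are not abstractions; only these contribute min∞ (deg t) (suc∞ (deg s)).
data NonAbs : Tm → Set where
  var : ∀ {x} → NonAbs (var x)
  app : ∀ {t s} → NonAbs (app t s)

data AbsView : Tm → Set where
  abs    : ∀ a → AbsView (lam a)
  nonAbs : ∀ {t} → NonAbs t → AbsView t

absView : ∀ t → AbsView t
absView (var x)   = nonAbs var
absView (lam a)   = abs a
absView (app t s) = nonAbs app

deg-app : ∀ {t} s → NonAbs t → deg (app t s) ≡ min∞ (deg t) (suc∞ (deg s))
deg-app s var = refl
deg-app s app = refl

-- In general deg (app t s) is at most the minimum (a redex head only lowers it to 0).
deg-app-≼ : ∀ t s → deg (app t s) ≼ min∞ (deg t) (suc∞ (deg s))
deg-app-≼ (var x)   s = ≼-reflexive refl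
deg-app-≼ (lam a)   s = z≼ _
deg-app-≼ (app t u) s = ≼-reflexive refl

deg-app-lower : ∀ {t s x} → NonAbs t → x ≼ deg (app t s) → (x ≼ deg t) × (x ≼ suc∞ (deg s))
deg-app-lower {t} {s} {x} nt h =
  ≼-trans h′ (min∞-≼ˡ _ _) , ≼-trans h′ (min∞-≼ʳ _ _)
  where
    h′ : x ≼ min∞ (deg t) (suc∞ (deg s))
    h′ = ≼-trans h (≼-reflexive (deg-app s nt))

≼-deg-app : ∀ {t s x} → NonAbs t → x ≼ deg t → x ≼ suc∞ (deg s) → x ≼ deg (app t s)
≼-deg-app {s = s} nt h₁ h₂ = ≼-trans (min∞-glb h₁ h₂) (≼-reflexive (sym (deg-app s nt)))

deg-app-fin : ∀ {t s d} → NonAbs t → deg (app t s) ≡ fin d →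
              (deg t ≡ fin d) ⊎ (suc∞ (deg s) ≡ fin d)
deg-app-fin {t} {s} nt e = min∞-fin (deg t) (suc∞ (deg s)) (trans (sym (deg-app s nt)) e)

nonAbs-step : ∀ {t u k} → NonAbs t → t →β[ suc k ] u → NonAbs u
nonAbs-step app (ξl p) = app
nonAbs-step app (ξr p) = app

level-bounds-deg : ∀ {t s k} → t →β[ k ] s → deg t ≼ fin k
level-bounds-deg β        = z≼ _
level-bounds-deg (ξlam p) = level-bounds-deg p
level-bounds-deg (ξl {t} {s = s} p) =
  ≼-trans (deg-app-≼ t s) (≼-trans (min∞-≼ˡ _ _) (level-bounds-deg p))
level-bounds-deg (ξr {s} {t} p) =
  ≼-trans (deg-app-≼ s t) (≼-trans (min∞-≼ʳ _ _) (suc∞-mono (level-bounds-deg p)))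

step-at-deg : ∀ t {d} → deg t ≡ fin d → ∃ λ s → t →β[ d ] s
step-app    : ∀ t s {d} → NonAbs t → deg (app t s) ≡ fin d → ∃ λ u → app t s →β[ d ] u

step-at-deg (var x)           ()
step-at-deg (lam t)           e    = map lam ξlam (step-at-deg t e)
step-at-deg (app (lam a) b)   refl = _ , β
step-at-deg (app (var x) b)   e    = step-app (var x) b var e
step-at-deg (app (app a c) b) e    = step-app (app a c) b app e

step-app t s nt e with deg-app-fin nt e
... | inj₁ e₁ = map (λ t′ → app t′ s) ξl (step-at-deg t e₁)
... | inj₂ e₂ with suc∞-fin (deg s) e₂
...   | m , e₃ , refl = map (app t) ξr (step-at-deg s e₃)

ℓℓ-deg-mono : ∀ {t s k} → t →β[ k ] s → deg t ≡ fin k → fin k ≼ deg s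
ℓℓ-deg-mono {s = s} β e = z≼ (deg s)
ℓℓ-deg-mono (ξlam p) e  = ℓℓ-deg-mono p e
ℓℓ-deg-mono (ξl {t} p) e with absView t
ℓℓ-deg-mono (ξl p) refl | abs a = z≼ _
ℓℓ-deg-mono {k = k} (ξl {t} {t′} {s} p) e | nonAbs nt =
  lower-app k p (ℓℓ-deg-mono p deg-t) bound-s
  where
    bounds : (fin k ≼ deg t) × (fin k ≼ suc∞ (deg s))
    bounds = deg-app-lower nt (≼-reflexive (sym e))
    bound-s : fin k ≼ suc∞ (deg s)
    bound-s = proj₂ bounds
    deg-t : deg t ≡ fin k
    deg-t = ≼-antisym (level-bounds-deg p) (proj₁ bounds)
    -- if t′ became an abstraction the step was a β-contraction, so k = 0
    lower-app : ∀ k → t →β[ k ] t′ → fin k ≼ deg t′ → fin k ≼ suc∞ (deg s) →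
                fin k ≼ deg (app t′ s)
    lower-app zero    _ _  _  = z≼ _
    lower-app (suc k) p h₁ h₂ = ≼-deg-app (nonAbs-step nt p) h₁ h₂
ℓℓ-deg-mono (ξr {s} p) e with absView s
ℓℓ-deg-mono (ξr p) () | abs a
ℓℓ-deg-mono {k = suc k} (ξr {s} {t} {t′} p) e | nonAbs ns =
  ≼-deg-app ns bound-s (suc∞-mono (ℓℓ-deg-mono p deg-t))
  where
    bounds : (fin (suc k) ≼ deg s) × (fin (suc k) ≼ suc∞ (deg t))
    bounds = deg-app-lower ns (≼-reflexive (sym e))
    bound-s : fin (suc k) ≼ deg s
    bound-s = proj₁ bounds
    deg-t : deg t ≡ fin k
    deg-t = ≼-antisym (level-bounds-deg p) (suc∞-cancel (deg t) (proj₂ bounds))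

-- A step of level k above the degree d leaves a reducible term: either the d-redex is
-- untouched, or the component realising the degree is still independently reducible.
persistence-step : ∀ {t s k d} → t →β[ k ] s → deg t ≡ fin d → d < k → ∃ λ u → s →β u
persistence-step β _ ()
persistence-step (ξlam p) e d<k = map lam (map₂ ξlam) (persistence-step p e d<k)
persistence-step (ξl {t = lam a} (ξlam p)) _ _ = _ , 0 , β
persistence-step (ξl {t = app a b} {t′} {s} p) e d<k with deg-app-fin {app a b} {s} app e
... | inj₁ e₁ = map (λ u → app u s) (map₂ ξl) (persistence-step p e₁ d<k)
... | inj₂ e₂ with suc∞-fin (deg s) e₂
...   | m , e₃ , refl = map (app t′) (λ q → suc m , ξr q) (step-at-deg s e₃)
persistence-step (ξr {s} p) e d<k with absView s
... | abs a = _ , 0 , β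
persistence-step (ξr {s} {t} {t′} p) e d<k | nonAbs ns with deg-app-fin ns e
... | inj₁ e₁ = map (λ u → app u t′) (λ q → _ , ξl q) (step-at-deg s e₁)
... | inj₂ e₂ with suc∞-fin (deg t) e₂
persistence-step (ξr {s} {t} {t′} p) e (s≤s m<k) | nonAbs ns | inj₂ e₂ | m , e₃ , refl =
  map (app s) (λ (k , q) → suc k , ξr q) (persistence-step p e₃ m<k)

level-diamond : ∀ {t s u k} → t →β[ k ] s → t →β[ k ] u → ¬ (s ≡ u) →
                ∃ λ r → (s →β[ k ] r) × (u →β[ k ] r)
level-diamond β β s≢u with () ← s≢u refl
level-diamond (β {s = b}) (ξl (ξlam {t' = a′} q)) _ = a′ [ b ] , →β-subst (sub0 b) q , β
level-diamond (ξl (ξlam {t' = a′} p)) (β {s = b}) _ = a′ [ b ] , β , →β-subst (sub0 b) p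
level-diamond (ξlam p) (ξlam q) s≢u =
  map lam (map ξlam ξlam) (level-diamond p q (λ e → s≢u (cong lam e)))
level-diamond (ξl {s = b} p) (ξl q) s≢u =
  map (λ r → app r b) (map ξl ξl) (level-diamond p q (λ e → s≢u (cong (λ x → app x b) e)))
level-diamond (ξl {t' = a′} p) (ξr {t' = b′} q) _ = app a′ b′ , ξr q , ξl p
level-diamond (ξr {t' = b′} p) (ξl {t' = a′} q) _ = app a′ b′ , ξl q , ξr p
level-diamond (ξr {s = a} p) (ξr q) s≢u =
  map (app a) (map ξr ξr) (level-diamond p q (λ e → s≢u (cong (app a) e)))

ℓℓ-reduct-deg : ∀ {t s r k} → t →β[ k ] s → deg t ≡ fin k → s →β[ k ] r → deg s ≡ fin k
ℓℓ-reduct-deg p e q = ≼-antisym (level-bounds-deg q) (ℓℓ-deg-mono p e)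

fullness : ∀ {t s} → t →β s → ∃ λ u → t →ℓℓ u
fullness {t} (k , p) with ≼fin⇒fin (level-bounds-deg p)
... | d , e = map₂ (λ q → d , q , e) (step-at-deg t e)

-- Persistence: any step above the degree leaves a reducible term, which then has an ℓℓ-step
-- by fullness.
persistence : ∀ {t s₁ s₂} → t →ℓℓ s₁ → t →¬ℓℓ s₂ → ∃ λ u → s₂ →ℓℓ u
persistence _ (k , p , d , e , d<k) = fullness (proj₂ (persistence-step p e d<k))

diamond : ∀ {t s u} → t →ℓℓ s → t →ℓℓ u → ¬ (s ≡ u) → ∃ λ r → (s →ℓℓ r) × (u →ℓℓ r)
diamond (k , p , e) (_ , q , e′) s≢u with trans (sym e) e′
... | refl with level-diamond p q s≢u
...   | r , p′ , q′ = r , (k , p′ , ℓℓ-reduct-deg p e p′) , (k , q′ , ℓℓ-reduct-deg q e′ q′)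

proposition9 :
    (∀ {t s} → t →β s → ∃ λ u → t →ℓℓ u)
    × (∀ {t s₁ s₂} → t →ℓℓ s₁ → t →¬ℓℓ s₂ → ∃ λ u → s₂ →ℓℓ u)
    × (∀ {t s u} → t →ℓℓ s → t →ℓℓ u → ¬ (s ≡ u) → ∃ λ r → (s →ℓℓ r) × (u →ℓℓ r))
proposition9 = fullness , persistence , diamond
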